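{- Let $n\ge1$ and $S=[n]$. For every $\sigma\in\mathcal{R}_n^B$, $\mathrm{dasc}(\psi_S(\sigma))=\mathrm{ddesc}(\sigma)$ and $\mathrm{ddesc}(\psi_S(\sigma))=\mathrm{dasc}(\sigma)$.
   Context: $[n]=\{1,\dots,n\}$, $\langle n\rangle=\{0,\pm1,\dots,\pm n\}$. A type $B$ set partition of $\langle n\rangle$ without zero block is encoded as $\pi=\pi_1\mid\cdots\mid\pi_k$: nonempty sets of nonzero integers with the sets $\{|a|:a\in\pi_i\}$ partitioning $[n]$, the element of smallest absolute value $m_i$ of $\pi_i$ positive, $m_1<\cdots<m_k$. It is merging-free if there is no $i\ge2$ with $\max_{a\in\pi_{i-1}}|a|<m_i$. $\mathrm{Flatten}(\pi)$ concatenates $\pi_1,\pi_2,\dots$, each written in increasing order of absolute value; $\mathcal{R}_n^B$ is the set of $\mathrm{Flatten}(\pi)$ over merging-free $\pi$. For $\sigma=\sigma_1\cdots\sigma_n$, a modular run (mrun) is a maximal consecutive segment $\sigma_i\cdots\sigma_{i+j}$ with $|\sigma_i|<\cdots<|\sigma_{i+j}|$; $\sigma_i$ is its bottom. For $i\in[n]$, $\psi_i(\sigma)$ is $\sigma$ with $\sigma_i$ replaced by $-\sigma_i$ if $\sigma_i$ is not the bottom of an mrun, and $\psi_i(\sigma)=\sigma$ otherwise; $\psi_S=\prod_{i\in S}\psi_i$ (these commute). For $2\le i\le n-1$, $\sigma_i$ is a double ascent if $\sigma_{i-1}<\sigma_i<\sigma_{i+1}$ and a double descent if $\sigma_{i-1}>\sigma_i>\sigma_{i+1}$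 (usual integer order); $\mathrm{dasc}$, $\mathrm{ddesc}$ count them. -}

module Defs where

open import Data.Nat as ℕ using (ℕ; zero; suc; _∸_; _⊔_)
open import Data.Integer as ℤ using (ℤ; ∣_∣; -_; 0ℤ)
open import Data.Bool using (Bool; true; false; if_then_else_; _∧_)
open import Data.List using (List; []; _∷_; map; concat; length; foldr; upTo; filter)
open import Data.List.Relation.Unary.All using (All)
open import Data.List.Relation.Unary.Linked using (Linked)
open import Data.List.Relation.Binary.Permutation.Propositional using (_↭_)
open import Data.Product using (Σ; _×_)
open import Data.Empty using (⊥)
open import Relation.Nullary using (¬_)
open import Relation.Binary.PropositionalEquality using (_≡_)
import Relation.Nullary.Decidable as Dec
open import Data.Product using (_,_)

range1 : ℕ → List ℕ
range1 n = map suc (upTo n)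

-- Type B set partitions without zero block, encoded as a list of blocks.
-- Each block (a set) is represented by the list of its elements written in
-- increasing order of absolute value.

headAbs : List ℤ → ℕ
headAbs []      = 0
headAbs (a ∷ _) = ∣ a ∣

maxAbs : List ℤ → ℕ
maxAbs b = foldr _⊔_ 0 (map ∣_∣ b)

IsBlock : List ℤ → Set
IsBlock []      = ⊥
IsBlock (a ∷ as) = (ℤ.0ℤ ℤ.< a) × Linked (λ x y → ∣ x ∣ ℕ.< ∣ y ∣) (a ∷ as)

IsTypeBPartition : ℕ → List (List ℤ) → Set
IsTypeBPartition n π =
  All IsBlock π
  × (concat (map (map ∣_∣) π) ↭ range1 n)
  × Linked (λ b c → headAbs b ℕ.< headAbs c) π

MergingFree : List (List ℤ) → Set
MergingFree π = Linked (λ b c → ¬ (maxAbs b ℕ.< headAbs c)) π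

Flatten : List (List ℤ) → List ℤ
Flatten = concat

InRB : ℕ → List ℤ → Set
InRB n σ = Σ (List (List ℤ)) λ π → IsTypeBPartition n π × MergingFree π × (Flatten π ≡ σ)

-- Words, 1-indexed access (default 0 outside range)

at : List ℤ → ℕ → ℤ
at []       _             = 0ℤ
at (x ∷ xs) zero          = 0ℤ
at (x ∷ xs) (suc zero)    = x
at (x ∷ xs) (suc (suc k)) = at xs (suc k)

negateAt : ℕ → List ℤ → List ℤ
negateAt _             []       = []
negateAt zero          (x ∷ xs) = x ∷ xs
negateAt (suc zero)    (x ∷ xs) = - x ∷ xs
negateAt (suc (suc k)) (x ∷ xs) = x ∷ negateAt (suc k) xs

-- σ_i is NOT the bottom of its modular run: i ≥ 2, i ≤ length σ and
-- |σ_{i-1}| < |σ_i| (so σ_{i-1} belongs to the same mrun)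
notBottom : List ℤ → ℕ → Bool
notBottom σ i = Dec.⌊ 2 ℕ.≤? i ⌋ ∧ Dec.⌊ i ℕ.≤? length σ ⌋
                ∧ Dec.⌊ ∣ at σ (i ∸ 1) ∣ ℕ.<? ∣ at σ i ∣ ⌋

ψ : ℕ → List ℤ → List ℤ
ψ i σ = if notBottom σ i then negateAt i σ else σ

ψS : List ℕ → List ℤ → List ℤ
ψS S σ = foldr ψ σ S

innerPositions : List ℤ → List ℕ
innerPositions σ = map (λ k → 2 ℕ.+ k) (upTo (length σ ∸ 2))

IsDAsc : List ℤ → ℕ → Set
IsDAsc σ i = (at σ (i ∸ 1) ℤ.< at σ i) × (at σ i ℤ.< at σ (suc i))

IsDDesc : List ℤ → ℕ → Set
IsDDesc σ i = (at σ (i ∸ 1) ℤ.> at σ i) × (at σ i ℤ.> at σ (suc i))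

isDAsc? : (σ : List ℤ) → (i : ℕ) → Dec.Dec (IsDAsc σ i)
isDAsc? σ i = (at σ (i ∸ 1) ℤ.<? at σ i) Dec.×-dec (at σ i ℤ.<? at σ (suc i))

isDDesc? : (σ : List ℤ) → (i : ℕ) → Dec.Dec (IsDDesc σ i)
isDDesc? σ i = (at σ i ℤ.<? at σ (i ∸ 1)) Dec.×-dec (at σ (suc i) ℤ.<? at σ i)

dasc : List ℤ → ℕ
dasc σ = length (filter (isDAsc? σ) (innerPositions σ))

ddesc : List ℤ → ℕ
ddesc σ = length (filter (isDDesc? σ) (innerPositions σ))

{-# OPTIONS --safe #-}
-- ψ_i only changes signs, so the absolute values of σ, and with them its mrun bottoms, are
-- the same at every stage of ψ_[n]; hence ψ_[n] negates exactly the letters that are not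
-- bottoms. In a merging-free partition every block but the last has at least two letters, so
-- no two neighbouring letters are both bottoms. If |σ_j| < |σ_{j+1}| then σ_{j+1} is negated;
-- otherwise σ_{j+1} is a bottom and σ_j is negated. Either way the letter of larger absolute
-- value changes sign, and since that letter's sign decides the comparison of the pair, every
-- comparison between neighbours is reversed, which swaps double ascents and double descents.

module Submission where

open import Defs
open import Data.Nat using (ℕ; _≤_)
open import Data.Integer using (ℤ)
open import Data.List using (List)
open import Data.Product using (_×_)
open import Relation.Binary.PropositionalEquality using (_≡_)

open import Data.Bool using (true; false; if_then_else_; _∧_)
open import Data.Bool.Properties using (∧-zeroʳ)
open import Data.Empty using (⊥-elim)
open import Data.Integer using (_<_; -_; ∣_∣; 0ℤ; +_; -[1+_]; +<+; -<+; -<-)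
open import Data.Integer.Properties using (neg-mono-<; neg-cancel-<; ∣-i∣≡∣i∣)
open import Data.List using ([]; _∷_; _++_; map; concat; length; filter; upTo)
open import Data.List.Membership.Propositional using (_∈_; _∉_)
open import Data.List.Membership.Propositional.Properties using (∈-map⁺; ∈-upTo⁺)
open import Data.List.Properties using (concat-map; length-map; length-upTo)
open import Data.List.Relation.Binary.Permutation.Propositional using (_↭_; ↭-sym; ↭⇒↭ₛ)
open import Data.List.Relation.Binary.Permutation.Propositional.Properties using (↭-length)
open import Data.List.Relation.Binary.Permutation.Setoid.Properties using (Unique-resp-↭)
open import Data.List.Relation.Unary.All using (All; []; _∷_)
import Data.List.Relation.Unary.All.Properties as All
open import Data.List.Relation.Unary.AllPairs using (_∷_)
open import Data.List.Relation.Unary.Any using (here; there)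
open import Data.List.Relation.Unary.Linked as Linked using (Linked; [-]; _∷_)
open import Data.List.Relation.Unary.Unique.Propositional using (Unique)
import Data.List.Relation.Unary.Unique.Propositional.Properties as Unique
open import Data.Nat as ℕ using (zero; suc; _+_; _∸_; z≤n; s≤s; s≤s⁻¹; _≟_; _≤?_; _<?_)
open import Data.Nat.Properties using (<-asym; <⇒≤; <-cmp; suc-injective; ⊔-identityʳ)
open import Data.Product using (_,_; proj₁; proj₂)
open import Data.Product.Function.NonDependent.Propositional using (_×-⇔_)
open import Function using (id; _∘_; _⇔_; mk⇔; Equivalence)
import Function.Properties.Equivalence as ⇔
open import Level using (0ℓ)
open import Relation.Binary using (tri<; tri≈; tri>)
open import Relation.Binary.PropositionalEquality
  using (_≢_; refl; sym; trans; cong; cong₂; subst; setoid; module ≡-Reasoning)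
open import Relation.Nullary using (¬_; Dec; yes; no)
open import Relation.Nullary.Decidable using (isYes; isYes≗does; dec-true; dec-false)
open import Relation.Unary using (Pred; Decidable)

Reverses : ℤ → ℤ → ℤ → ℤ → Set
Reverses x′ y′ x y = (x′ < y′ ⇔ y < x) × (y′ < x′ ⇔ x < y)

∣<∣⇒<⇔0< : ∀ {a b} → ∣ a ∣ ℕ.< ∣ b ∣ → a < b ⇔ 0ℤ < b
∣<∣⇒<⇔0< {+ _}      {+ suc _}  p = mk⇔ (λ _ → +<+ ℕ.z<s) (λ _ → +<+ p)
∣<∣⇒<⇔0< { -[1+ _ ]} {+ suc _}  p = mk⇔ (λ _ → +<+ ℕ.z<s) (λ _ → -<+)
∣<∣⇒<⇔0< {+ _}      { -[1+ _ ]} p = mk⇔ (λ ()) (λ ())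
∣<∣⇒<⇔0< { -[1+ _ ]} { -[1+ _ ]} p = mk⇔ (λ { (-<- q) → ⊥-elim (<-asym q (s≤s⁻¹ p)) }) (λ ())

∣<∣⇒>⇔<0 : ∀ {a b} → ∣ a ∣ ℕ.< ∣ b ∣ → b < a ⇔ b < 0ℤ
∣<∣⇒>⇔<0 {+ _}      {+ suc _}  p = mk⇔ (λ { (+<+ q) → ⊥-elim (<-asym p q) }) (λ { (+<+ ()) })
∣<∣⇒>⇔<0 { -[1+ _ ]} {+ suc _}  p = mk⇔ (λ ()) (λ { (+<+ ()) })
∣<∣⇒>⇔<0 {+ _}      { -[1+ _ ]} p = mk⇔ (λ _ → -<+) (λ _ → -<+)
∣<∣⇒>⇔<0 { -[1+ _ ]} { -[1+ _ ]} p = mk⇔ (λ _ → -<+) (λ _ → -<- (s≤s⁻¹ p))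

sign-irrelevantˡ : ∀ {a a′ b} → ∣ a′ ∣ ≡ ∣ a ∣ → ∣ a ∣ ℕ.< ∣ b ∣ → a′ < b ⇔ a < b
sign-irrelevantˡ eq p = ⇔.trans (∣<∣⇒<⇔0< (subst (ℕ._< _) (sym eq) p)) (⇔.sym (∣<∣⇒<⇔0< p))

sign-irrelevantʳ : ∀ {a a′ b} → ∣ a′ ∣ ≡ ∣ a ∣ → ∣ a ∣ ℕ.< ∣ b ∣ → b < a′ ⇔ b < a
sign-irrelevantʳ eq p = ⇔.trans (∣<∣⇒>⇔<0 (subst (ℕ._< _) (sym eq) p)) (⇔.sym (∣<∣⇒>⇔<0 p))

neg-<⇔> : ∀ {a b} → - a < - b ⇔ b < a
neg-<⇔> = mk⇔ neg-cancel-< neg-mono-<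

reverses-ascent : ∀ {x x′ y} → ∣ x′ ∣ ≡ ∣ x ∣ → ∣ x ∣ ℕ.< ∣ y ∣ → Reverses x′ (- y) x y
reverses-ascent {x} {x′} {y} eq x<y =
  ⇔.trans (sign-irrelevantˡ eq′ -x<-y) neg-<⇔> , ⇔.trans (sign-irrelevantʳ eq′ -x<-y) neg-<⇔>
  where
  eq′ : ∣ x′ ∣ ≡ ∣ - x ∣
  eq′ = trans eq (sym (∣-i∣≡∣i∣ x))
  -x<-y : ∣ - x ∣ ℕ.< ∣ - y ∣
  -x<-y rewrite ∣-i∣≡∣i∣ x | ∣-i∣≡∣i∣ y = x<y

reverses-descent : ∀ {x y} → ∣ y ∣ ℕ.< ∣ x ∣ → Reverses (- x) y x y
reverses-descent {x} {y} y<x =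
  ⇔.trans (sign-irrelevantʳ eq -y<-x) neg-<⇔> , ⇔.trans (sign-irrelevantˡ eq -y<-x) neg-<⇔>
  where
  eq : ∣ y ∣ ≡ ∣ - y ∣
  eq = sym (∣-i∣≡∣i∣ y)
  -y<-x : ∣ - y ∣ ℕ.< ∣ - x ∣
  -y<-x rewrite ∣-i∣≡∣i∣ x | ∣-i∣≡∣i∣ y = y<x

filter-≐-on : ∀ {A : Set} {P Q : Pred A 0ℓ} (P? : Decidable P) (Q? : Decidable Q) {xs} →
              All (λ x → P x ⇔ Q x) xs → filter P? xs ≡ filter Q? xs
filter-≐-on P? Q? [] = refl
filter-≐-on P? Q? {x ∷ _} (P⇔Q ∷ P⇔Qs) with P? x | Q? x
... | yes _  | yes _  = cong (x ∷_) (filter-≐-on P? Q? P⇔Qs)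
... | no _   | no _   = filter-≐-on P? Q? P⇔Qs
... | yes p  | no ¬q  = ⊥-elim (¬q (Equivalence.to P⇔Q p))
... | no ¬p  | yes q  = ⊥-elim (¬p (Equivalence.from P⇔Q q))

ComparisonsReversed : List ℤ → List ℤ → Set
ComparisonsReversed τ σ = ∀ j → 1 ≤ j → suc j ≤ length σ →
  Reverses (at τ j) (at τ (suc j)) (at σ j) (at σ (suc j))

<∸2⇒3+≤ : ∀ {k} L → k ℕ.< L ∸ 2 → 3 + k ≤ L
<∸2⇒3+≤ (suc (suc L)) k<L = s≤s (s≤s k<L)

dasc-ddesc-swap : ∀ τ σ → length τ ≡ length σ → ComparisonsReversed τ σ →
                  dasc τ ≡ ddesc σ × ddesc τ ≡ dasc σ
dasc-ddesc-swap τ σ |τ|≡|σ| rev =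
  count (isDAsc? τ) (isDDesc? σ) (λ r₁ r₂ → proj₁ r₁ ×-⇔ proj₁ r₂) ,
  count (isDDesc? τ) (isDAsc? σ) (λ r₁ r₂ → proj₂ r₁ ×-⇔ proj₂ r₂)
  where
  open ≡-Reasoning
  count : ∀ {P Q : Pred ℕ 0ℓ} (P? : Decidable P) (Q? : Decidable Q) →
          (∀ {k} → Reverses (at τ (1 + k)) (at τ (2 + k)) (at σ (1 + k)) (at σ (2 + k)) →
                   Reverses (at τ (2 + k)) (at τ (3 + k)) (at σ (2 + k)) (at σ (3 + k)) →
                   P (2 + k) ⇔ Q (2 + k)) →
          length (filter P? (innerPositions τ)) ≡ length (filter Q? (innerPositions σ))
  count {P} {Q} P? Q? P⇔Q = begin
    length (filter P? (innerPositions τ))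
      ≡⟨ cong (λ L → length (filter P? (map (λ k → 2 + k) (upTo (L ∸ 2))))) |τ|≡|σ| ⟩
    length (filter P? (innerPositions σ))
      ≡⟨ cong length (filter-≐-on P? Q? (All.map⁺ (All.applyUpTo⁺₁ id (length σ ∸ 2) P⇔Q-inner))) ⟩
    length (filter Q? (innerPositions σ)) ∎
    where
    P⇔Q-inner : ∀ {k} → k ℕ.< length σ ∸ 2 → P (2 + k) ⇔ Q (2 + k)
    P⇔Q-inner {k} k< = P⇔Q (rev (1 + k) (s≤s z≤n) (<⇒≤ (<∸2⇒3+≤ (length σ) k<)))
                            (rev (2 + k) (s≤s z≤n) (<∸2⇒3+≤ (length σ) k<))

length-negateAt : ∀ i σ → length (negateAt i σ) ≡ length σ
length-negateAt _             []       = refl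
length-negateAt zero          (x ∷ xs) = refl
length-negateAt (suc zero)    (x ∷ xs) = refl
length-negateAt (suc (suc i)) (x ∷ xs) = cong suc (length-negateAt (suc i) xs)

at-negateAt-≡ : ∀ i σ → at (negateAt i σ) i ≡ - at σ i
at-negateAt-≡ _             []       = refl
at-negateAt-≡ zero          (x ∷ xs) = refl
at-negateAt-≡ (suc zero)    (x ∷ xs) = refl
at-negateAt-≡ (suc (suc i)) (x ∷ xs) = at-negateAt-≡ (suc i) xs

at-negateAt-≢ : ∀ {i j} σ → i ≢ j → at (negateAt i σ) j ≡ at σ j
at-negateAt-≢                              []       _   = refl
at-negateAt-≢ {zero}                       (x ∷ xs) _   = refl
at-negateAt-≢ {suc zero}    {zero}         (x ∷ xs) _   = refl
at-negateAt-≢ {suc zero}    {suc zero}     (x ∷ xs) i≢j = ⊥-elim (i≢j refl)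
at-negateAt-≢ {suc zero}    {suc (suc j)}  (x ∷ xs) _   = refl
at-negateAt-≢ {suc (suc i)} {zero}         (x ∷ xs) _   = refl
at-negateAt-≢ {suc (suc i)} {suc zero}     (x ∷ xs) _   = refl
at-negateAt-≢ {suc (suc i)} {suc (suc j)}  (x ∷ xs) i≢j = at-negateAt-≢ xs (i≢j ∘ cong suc)

∣at-negateAt∣ : ∀ i σ j → ∣ at (negateAt i σ) j ∣ ≡ ∣ at σ j ∣
∣at-negateAt∣ i σ j with i ≟ j
... | yes refl = trans (cong ∣_∣ (at-negateAt-≡ i σ)) (∣-i∣≡∣i∣ (at σ i))
... | no i≢j   = cong ∣_∣ (at-negateAt-≢ σ i≢j)

length-ψ : ∀ i σ → length (ψ i σ) ≡ length σ
length-ψ i σ with notBottom σ i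
... | true  = length-negateAt i σ
... | false = refl

∣at-ψ∣ : ∀ i σ j → ∣ at (ψ i σ) j ∣ ≡ ∣ at σ j ∣
∣at-ψ∣ i σ j with notBottom σ i
... | true  = ∣at-negateAt∣ i σ j
... | false = refl

at-ψ-≡ : ∀ i σ → at (ψ i σ) i ≡ (if notBottom σ i then - at σ i else at σ i)
at-ψ-≡ i σ with notBottom σ i
... | true  = at-negateAt-≡ i σ
... | false = refl

at-ψ-≢ : ∀ {i j} σ → i ≢ j → at (ψ i σ) j ≡ at σ j
at-ψ-≢ {i} σ i≢j with notBottom σ i
... | true  = at-negateAt-≢ σ i≢j
... | false = refl

length-ψS : ∀ S σ → length (ψS S σ) ≡ length σ
length-ψS []      σ = refl
length-ψS (i ∷ S) σ = trans (length-ψ i (ψS S σ)) (length-ψS S σ)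

∣at-ψS∣ : ∀ S σ j → ∣ at (ψS S σ) j ∣ ≡ ∣ at σ j ∣
∣at-ψS∣ []      σ j = refl
∣at-ψS∣ (i ∷ S) σ j = trans (∣at-ψ∣ i (ψS S σ) j) (∣at-ψS∣ S σ j)

notBottom-ψS : ∀ S σ j → notBottom (ψS S σ) j ≡ notBottom σ j
notBottom-ψS S σ j rewrite length-ψS S σ | ∣at-ψS∣ S σ (j ∸ 1) | ∣at-ψS∣ S σ j = refl

at-ψS-∉ : ∀ {j} S σ → j ∉ S → at (ψS S σ) j ≡ at σ j
at-ψS-∉ []      σ _   = refl
at-ψS-∉ (i ∷ S) σ j∉S =
  trans (at-ψ-≢ {i} (ψS S σ) (λ i≡j → j∉S (here (sym i≡j)))) (at-ψS-∉ S σ (j∉S ∘ there))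

at-ψS-∈ : ∀ {j} S σ → Unique S → j ∈ S → at (ψS S σ) j ≡ (if notBottom σ j then - at σ j else at σ j)
at-ψS-∈ (i ∷ S) σ (i≢S ∷ _) (here refl) = begin
  at (ψ i (ψS S σ)) i
    ≡⟨ at-ψ-≡ i (ψS S σ) ⟩
  (if notBottom (ψS S σ) i then - at (ψS S σ) i else at (ψS S σ) i)
    ≡⟨ cong (λ b → if b then - at (ψS S σ) i else at (ψS S σ) i) (notBottom-ψS S σ i) ⟩
  (if notBottom σ i then - at (ψS S σ) i else at (ψS S σ) i)
    ≡⟨ cong (λ x → if notBottom σ i then - x else x) (at-ψS-∉ S σ (All.All¬⇒¬Any i≢S)) ⟩
  (if notBottom σ i then - at σ i else at σ i) ∎
  where open ≡-Reasoning
at-ψS-∈ (i ∷ S) σ (i≢S ∷ S-unique) (there j∈S) =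
  trans (at-ψ-≢ {i} (ψS S σ) (λ { refl → All.All¬⇒¬Any i≢S j∈S })) (at-ψS-∈ S σ S-unique j∈S)

range1-unique : ∀ n → Unique (range1 n)
range1-unique n = Unique.map⁺ suc-injective (Unique.upTo⁺ n)

∈-range1 : ∀ {j n} → 1 ≤ j → j ≤ n → j ∈ range1 n
∈-range1 {suc j} _ j<n = ∈-map⁺ suc (∈-upTo⁺ j<n)

at-ψ-range1 : ∀ {j n} σ → 1 ≤ j → j ≤ n →
             at (ψS (range1 n) σ) j ≡ (if notBottom σ j then - at σ j else at σ j)
at-ψ-range1 {n = n} σ 1≤j j≤n = at-ψS-∈ (range1 n) σ (range1-unique n) (∈-range1 1≤j j≤n)

isYes-true : ∀ {A : Set} (a? : Dec A) → A → isYes a? ≡ true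
isYes-true a? a = trans (isYes≗does a?) (dec-true a? a)

isYes-false : ∀ {A : Set} (a? : Dec A) → ¬ A → isYes a? ≡ false
isYes-false a? ¬a = trans (isYes≗does a?) (dec-false a? ¬a)

notBottom-true : ∀ {σ j} → 2 ≤ j → j ≤ length σ → ∣ at σ (j ∸ 1) ∣ ℕ.< ∣ at σ j ∣ → notBottom σ j ≡ true
notBottom-true 2≤j j≤|σ| asc =
  cong₂ _∧_ (isYes-true (_ ≤? _) 2≤j) (cong₂ _∧_ (isYes-true (_ ≤? _) j≤|σ|) (isYes-true (_ <? _) asc))

notBottom-false : ∀ {σ j} → ¬ ∣ at σ (j ∸ 1) ∣ ℕ.< ∣ at σ j ∣ → notBottom σ j ≡ false
notBottom-false {σ} {j} ¬asc = begin
  isYes (2 ≤? j) ∧ isYes (j ≤? length σ) ∧ isYes (∣ at σ (j ∸ 1) ∣ <? ∣ at σ j ∣)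
    ≡⟨ cong (λ b → isYes (2 ≤? j) ∧ isYes (j ≤? length σ) ∧ b) (isYes-false (_ <? _) ¬asc) ⟩
  isYes (2 ≤? j) ∧ isYes (j ≤? length σ) ∧ false
    ≡⟨ cong (isYes (2 ≤? j) ∧_) (∧-zeroʳ _) ⟩
  isYes (2 ≤? j) ∧ false
    ≡⟨ ∧-zeroʳ _ ⟩
  false ∎
  where open ≡-Reasoning

data Start : Set where
  opening continuing : Start

-- LongSegments s σ: σ is a concatenation of segments increasing in absolute value, each of
-- length ≥ 2 except possibly the last; the index is continuing when the first letter of σ
-- belongs to a segment begun before σ.
data LongSegments : Start → List ℤ → Set where
  []      : LongSegments opening []
  end     : ∀ {s x} → LongSegments s (x ∷ [])
  ascend  : ∀ {s x y r} → ∣ x ∣ ℕ.< ∣ y ∣ → LongSegments continuing (y ∷ r) →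
            LongSegments s (x ∷ y ∷ r)
  restart : ∀ {x y r} → LongSegments opening (y ∷ r) → LongSegments continuing (x ∷ y ∷ r)

AscentAt : List ℤ → ℕ → Set
AscentAt σ j = ∣ at σ j ∣ ℕ.< ∣ at σ (suc j) ∣

descent⇒preceding-ascent : ∀ {s σ} → LongSegments s σ → ∀ j → 2 ≤ j → suc j ≤ length σ →
                           ¬ AscentAt σ j → AscentAt σ (j ∸ 1)
descent⇒preceding-ascent _                                    1 (s≤s ()) _ _
descent⇒preceding-ascent (ascend x<y _)                       2 _ _ _ = x<y
descent⇒preceding-ascent (restart {r = []} _)                 2 _ (s≤s (s≤s ())) _
descent⇒preceding-ascent (restart {r = _ ∷ _} (ascend y<z _)) 2 _ _ y≮z = ⊥-elim (y≮z y<z)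
descent⇒preceding-ascent end (suc (suc (suc j))) _ (s≤s ()) _
descent⇒preceding-ascent (ascend _ segs) (suc (suc (suc j))) _ (s≤s bound) ¬asc =
  descent⇒preceding-ascent segs (2 + j) (s≤s (s≤s z≤n)) bound ¬asc
descent⇒preceding-ascent (restart segs)  (suc (suc (suc j))) _ (s≤s bound) ¬asc =
  descent⇒preceding-ascent segs (2 + j) (s≤s (s≤s z≤n)) bound ¬asc

descent⇒notBottom : ∀ {σ j} → LongSegments opening σ → 1 ≤ j → suc j ≤ length σ →
                    ∣ at σ (suc j) ∣ ℕ.< ∣ at σ j ∣ → notBottom σ j ≡ true
descent⇒notBottom {j = 1} (ascend x<y _) _ _ y<x = ⊥-elim (<-asym x<y y<x)
descent⇒notBottom {j = 1} end _ (s≤s ()) _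
descent⇒notBottom {σ} {j@(suc (suc _))} segs _ bound desc =
  notBottom-true {σ} {j} (s≤s (s≤s z≤n)) (<⇒≤ bound)
    (descent⇒preceding-ascent segs j (s≤s (s≤s z≤n)) bound (<-asym desc))

continuing-++ : ∀ {a as ys} → Linked (λ x y → ∣ x ∣ ℕ.< ∣ y ∣) (a ∷ as) →
                LongSegments opening ys → LongSegments continuing ((a ∷ as) ++ ys)
continuing-++ {ys = []}    [-]            _    = end
continuing-++ {ys = _ ∷ _} [-]            segs = restart segs
continuing-++              (a<a′ ∷ block) segs = ascend a<a′ (continuing-++ block segs)

mergingFree⇒LongSegments : ∀ {π} → All IsBlock π → MergingFree π →
                           Linked (λ b c → headAbs b ℕ.< headAbs c) π → LongSegments opening (concat π)
mergingFree⇒LongSegments {[]} _ _ _ = []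
mergingFree⇒LongSegments {[] ∷ _} (() ∷ _) _ _
mergingFree⇒LongSegments {(a ∷ []) ∷ []} _ _ _ = end
mergingFree⇒LongSegments {(a ∷ []) ∷ c ∷ _} _ (merges ∷ _) (a<c ∷ _) =
  ⊥-elim (merges (subst (ℕ._< headAbs c) (sym (⊔-identityʳ ∣ a ∣)) a<c))
mergingFree⇒LongSegments {(a ∷ _ ∷ _) ∷ _} ((_ , a<a′ ∷ block) ∷ blocks) mergingFree heads =
  ascend a<a′ (continuing-++ block
    (mergingFree⇒LongSegments blocks (Linked.tail mergingFree) (Linked.tail heads)))

↭-range1⇒length≡ : ∀ {σ n} → map ∣_∣ σ ↭ range1 n → length σ ≡ n
↭-range1⇒length≡ {σ} {n} perm = begin
  length σ                ≡⟨ length-map ∣_∣ σ ⟨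
  length (map ∣_∣ σ)      ≡⟨ ↭-length perm ⟩
  length (range1 n)       ≡⟨ length-map suc (upTo n) ⟩
  length (upTo n)         ≡⟨ length-upTo n ⟩
  n                       ∎
  where open ≡-Reasoning

↭-range1⇒Unique : ∀ {σ n} → map ∣_∣ σ ↭ range1 n → Unique (map ∣_∣ σ)
↭-range1⇒Unique {n = n} perm = Unique-resp-↭ (setoid ℕ) (↭⇒↭ₛ (↭-sym perm)) (range1-unique n)

adjacent-abs-distinct : ∀ σ → Unique (map ∣_∣ σ) → ∀ j → 1 ≤ j → suc j ≤ length σ →
                        ∣ at σ j ∣ ≢ ∣ at σ (suc j) ∣
adjacent-abs-distinct (x ∷ y ∷ _) ((x≢y ∷ _) ∷ _) 1 _ _ = x≢y
adjacent-abs-distinct (x ∷ []) _ 1 _ (s≤s ())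
adjacent-abs-distinct (x ∷ σ) (_ ∷ unique) (suc (suc j)) _ (s≤s bound) =
  adjacent-abs-distinct σ unique (suc j) (s≤s z≤n) bound

ψ-range1-reverses : ∀ {n σ} → length σ ≡ n → LongSegments opening σ → Unique (map ∣_∣ σ) →
                    ComparisonsReversed (ψS (range1 n) σ) σ
ψ-range1-reverses {σ = σ} refl segs unique j 1≤j bound with <-cmp ∣ at σ j ∣ ∣ at σ (suc j) ∣
... | tri< asc _ _
  rewrite at-ψ-range1 σ (s≤s z≤n) bound | notBottom-true {σ} {suc j} (s≤s 1≤j) bound asc =
  reverses-ascent (∣at-ψS∣ (range1 (length σ)) σ j) asc
... | tri≈ _ eq _ = ⊥-elim (adjacent-abs-distinct σ unique j 1≤j bound eq)
... | tri> _ _ desc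
  rewrite at-ψ-range1 σ 1≤j (<⇒≤ bound) | at-ψ-range1 σ (s≤s z≤n) bound
        | descent⇒notBottom segs 1≤j bound desc | notBottom-false {σ} {suc j} (<-asym desc) =
  reverses-descent desc

mainTheorem16 : (n : ℕ) → 1 ≤ n → (σ : List ℤ) → InRB n σ →
    (dasc (ψS (range1 n) σ) ≡ ddesc σ) × (ddesc (ψS (range1 n) σ) ≡ dasc σ)
mainTheorem16 n _ σ (π , (blocks , perm , heads) , mergingFree , refl) =
  dasc-ddesc-swap (ψS (range1 n) σ) σ (length-ψS (range1 n) σ)
    (ψ-range1-reverses (↭-range1⇒length≡ absPerm)
                       (mergingFree⇒LongSegments blocks mergingFree heads)
                       (↭-range1⇒Unique absPerm))
  where
  absPerm : map ∣_∣ σ ↭ range1 n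
  absPerm = subst (_↭ range1 n) (concat-map π) perm
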